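{- Let $f:\{0,1\}^n\to\{\pm1\}$ be $k$-monotone. Then $\sum_{r=0}^{n-1}\mathbf I[f|_r]\le kn$.
   Context: $f:\{0,1\}^n\to\{\pm1\}$ is $k$-monotone if $(1-f)/2=g_1\oplus\cdots\oplus g_k$ for monotone $g_i:\{0,1\}^n\to\{0,1\}$ (monotone: $x\preceq y$ coordinatewise implies $g(x)\le g(y)$). $f|_r$ denotes the restriction of $f$ to the slice $\binom{[n]}{r}=\{x\in\{0,1\}^n:\sum_ix_i=r\}$ with the uniform distribution. For $g:\binom{[n]}{r}\to\{\pm1\}$ and $i,j\in[n]$, $\mathbf I_{ij}[g]=2\Pr_x[g(x^{(i,j)})\ne g(x)]$ where $x^{(i,j)}$ swaps coordinates $x_i,x_j$; the total influence is $\mathbf I[g]=\frac1n\sum_{1\le i<j\le n}\mathbf I_{ij}[g]$. -}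

module Defs where

open import Data.Bool using (Bool; true; false; _xor_; if_then_else_)
import Data.Bool as B
open import Data.Nat using (ℕ; zero; suc; _*_; _<ᵇ_)
open import Data.Fin using (Fin; toℕ; _≟_)
open import Data.Fin.Properties using () renaming (_≟_ to _≟F_)
open import Data.Integer using (+_)
open import Data.Rational using (ℚ; _/_; 0ℚ) renaming (_+_ to _+ℚ_; _*_ to _*ℚ_)
open import Data.Sign using (Sign) renaming (+ to plus; - to minus)
open import Data.List using (List; []; _∷_; _++_; map; filter; length; foldr; concatMap; allFin; upTo)
open import Data.Vec using (Vec; lookup; tabulate; count) renaming ([] to []ᵥ; _∷_ to _∷ᵥ_)
open import Data.Vec.Relation.Binary.Pointwise.Inductive using (Pointwise)
open import Relation.Nullary using (does)
open import Relation.Binary.PropositionalEquality using (_≡_)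
open import Data.Product using (Σ; _×_)

-- The Boolean cube {0,1}^n (false = 0, true = 1).
Cube : ℕ → Set
Cube n = Vec Bool n

_⪯_ : {n : ℕ} → Cube n → Cube n → Set
_⪯_ = Pointwise B._≤_

Monotone : {n : ℕ} → (Cube n → Bool) → Set
Monotone {n} g = ∀ (x y : Cube n) → x ⪯ y → g x B.≤ g y

-- (1 - f)/2 for f ∈ {±1}:  +1 ↦ 0,  -1 ↦ 1
bit : Sign → Bool
bit plus  = false
bit minus = true

xorAll : {k n : ℕ} → Vec (Cube n → Bool) k → Cube n → Bool
xorAll []ᵥ       x = false
xorAll (g ∷ᵥ gs) x = g x xor xorAll gs x

data AllMonotone {n : ℕ} : {k : ℕ} → Vec (Cube n → Bool) k → Set where
  []ᵐ  : AllMonotone []ᵥ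
  _∷ᵐ_ : ∀ {k g} {gs : Vec (Cube n → Bool) k} → Monotone g → AllMonotone gs → AllMonotone (g ∷ᵥ gs)

KMonotone : (k : ℕ) {n : ℕ} → (Cube n → Sign) → Set
KMonotone k {n} f = Σ (Vec (Cube n → Bool) k) λ gs →
  AllMonotone gs × (∀ (x : Cube n) → bit (f x) ≡ xorAll gs x)

allCubes : (n : ℕ) → List (Cube n)
allCubes zero    = []ᵥ ∷ []
allCubes (suc n) = concatMap (λ x → (false ∷ᵥ x) ∷ (true ∷ᵥ x) ∷ []) (allCubes n)

weight : {n : ℕ} → Cube n → ℕ
weight x = count (λ b → B.T? b) x

slice : (n r : ℕ) → List (Cube n)
slice n r = filter (λ x → weight x Data.Nat.≟ r) (allCubes n)

swap : {n : ℕ} → Fin n → Fin n → Cube n → Cube n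
swap i j x = tabulate λ l →
  if does (l ≟F i) then lookup x j else if does (l ≟F j) then lookup x i else lookup x l

signEq : Sign → Sign → Bool
signEq plus  plus  = true
signEq minus minus = true
signEq _     _     = false

-- a / b as a rational; the b = 0 branch is never used in the statement
-- (slices with r ≤ n are nonempty and n ≥ 1 whenever a term occurs)
frac : ℕ → ℕ → ℚ
frac a zero    = 0ℚ
frac a (suc b) = (+ a) / suc b

sumℚ : List ℚ → ℚ
sumℚ = foldr _+ℚ_ 0ℚ

Iij : {n : ℕ} → (Cube n → Sign) → (r : ℕ) → Fin n → Fin n → ℚ
Iij {n} f r i j =
  frac (2 * length (filter (λ x → B.T? (B.not (signEq (f (swap i j x)) (f x)))) (slice n r)))
       (length (slice n r))

pairs : (n : ℕ) → List (Fin n × Fin n)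
pairs n = concatMap (λ i → map (λ j → i Data.Product., j)
            (filter (λ j → Data.Nat._<?_ (toℕ i) (toℕ j)) (allFin n))) (allFin n)

Inf : {n : ℕ} → (Cube n → Sign) → ℕ → ℚ
Inf {n} f r = frac 1 n *ℚ sumℚ (map (λ p → Iij f r (Data.Product.proj₁ p) (Data.Product.proj₂ p)) (pairs n))

sliceInfSum : {n : ℕ} → (Cube n → Sign) → ℚ
sliceInfSum {n} f = sumℚ (map (Inf f) (upTo n))

module Submission where

-- Let g be monotone and let x have x_i = 0, x_j = 1. Both x and its swap x^(i,j) lie between x[j]≔0 and
-- x[i]≔1, so if g separates them then g changes along the cube edge x → x[i]≔1 (when g x = 0) or x[j]≔0 → x
-- (when g x = 1). Hence the swaps changing g on slice r number at most r·B_r + (n − r)·B_{r−1}, where B_r counts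
-- the edges between slices r and r + 1 along which g changes. Double counting those edges gives
-- B_r = (n − r)·|slice r|·(μ_{r+1} − μ_r), μ_r being the density of g on slice r, so by 4r(n − r) ≤ n² we get
-- I[g|_r] ≤ (n/2)(μ_{r+1} − μ_r) + (n/2)(μ_r − μ_{r−1}); both parts telescope and ∑_r I[g|_r] ≤ n. A swap changes
-- g₁ ⊕ ⋯ ⊕ g_k only if it changes some gᵢ, which gives k·n.

open import Defs

module _ where
  open import Algebra.Bundles using (CommutativeRing; CommutativeMonoid)
  open import Data.Bool as Bool using (Bool; true; false; not; _∧_; _xor_; if_then_else_; f≤t; b≤b)
  open import Data.Bool.Properties
    using (xor-same; xor-∧-commutativeRing; ≤-minimum; ≤-maximum) renaming (≤-reflexive to ≤-reflexiveᵇ)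
  open import Data.Empty using (⊥-elim)
  open import Data.Fin using (Fin; toℕ) renaming (zero to fzero; suc to fsuc)
  open import Data.Fin.Properties using (_≟_)
  open import Data.Integer as ℤ using (+≤+) renaming (+_ to pos)
  import Data.Integer.Properties as ℤ
  open import Data.List using (List; []; _∷_; _++_; map; filter; length; concat; concatMap; allFin; applyUpTo)
  open import Data.List.Properties using (map-tabulate)
  open import Data.Nat as ℕ using (ℕ; zero; suc; _+_; _*_; _∸_; z≤n; s≤s; _≤_; _<_)
  import Data.Nat.Properties as ℕ
  open import Data.Nat.Tactic.RingSolver using (solve)
  open import Data.Product using (_×_; _,_; proj₁; proj₂)
  open import Data.Rational as ℚ using (ℚ; 0ℚ; toℚᵘ) renaming (_+_ to _+ℚ_; _*_ to _*ℚ_; _≤_ to _≤ℚ_)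
  import Data.Rational.Properties as ℚ
  open import Data.Rational.Unnormalised as ℚᵘ using (mkℚᵘ; *≤*; *≡*)
  import Data.Rational.Unnormalised.Properties as ℚᵘ
  open import Data.Sign as Sign using (Sign)
  open import Data.Sum using (inj₁; inj₂)
  open import Data.Vec using (Vec; lookup; _[_]≔_; toList) renaming ([] to []ᵥ; _∷_ to _∷ᵥ_)
  import Data.Vec.Properties as Vecₚ
  import Data.Vec.Relation.Binary.Pointwise.Inductive as Pointwise
  open import Relation.Binary.PropositionalEquality
  open import Relation.Nullary using (Dec; does; yes; no)

  open import Algebra.Properties.CommutativeSemigroup ℕ.+-commutativeSemigroup
    using () renaming (interchange to +-interchange)
  open import Algebra.Properties.CommutativeSemigroup (CommutativeRing.+-commutativeSemigroup xor-∧-commutativeRing)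
    using () renaming (interchange to xor-interchange)
  open import Algebra.Properties.CommutativeSemigroup (CommutativeMonoid.commutativeSemigroup ℚ.+-0-commutativeMonoid)
    using () renaming (interchange to +ℚ-interchange)

  ⟦_⟧ : Bool → ℕ
  ⟦ true ⟧  = 1
  ⟦ false ⟧ = 0

  ⟦⟧≤1 : ∀ b → ⟦ b ⟧ ≤ 1
  ⟦⟧≤1 true  = s≤s z≤n
  ⟦⟧≤1 false = z≤n

  ⟦∧⟧ : ∀ a b → ⟦ a ∧ b ⟧ ≡ ⟦ a ⟧ * ⟦ b ⟧
  ⟦∧⟧ true  b = sym (ℕ.+-identityʳ ⟦ b ⟧)
  ⟦∧⟧ false b = refl

  ⟦xor⟧≤ : ∀ a b → ⟦ a xor b ⟧ ≤ ⟦ a ⟧ + ⟦ b ⟧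
  ⟦xor⟧≤ true  true  = z≤n
  ⟦xor⟧≤ true  false = s≤s z≤n
  ⟦xor⟧≤ false b     = ℕ.≤-refl

  ⟦∧⟧-split : ∀ c {a b} → a Bool.≤ b → ⟦ c ⟧ * ⟦ b ⟧ ≡ ⟦ c ∧ (not a ∧ b) ⟧ + ⟦ a ⟧ * ⟦ c ⟧
  ⟦∧⟧-split false f≤t        = refl
  ⟦∧⟧-split false {false} b≤b = refl
  ⟦∧⟧-split false {true}  b≤b = refl
  ⟦∧⟧-split true  f≤t        = refl
  ⟦∧⟧-split true  {false} b≤b = refl
  ⟦∧⟧-split true  {true}  b≤b = refl

  xor≤boundary : ∀ {s v u d} → s Bool.≤ u → d Bool.≤ s → ⟦ s xor v ⟧ ≤ ⟦ not v ∧ u ⟧ + ⟦ not d ∧ v ⟧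
  xor≤boundary {false} {v}   _   b≤b = ℕ.m≤n+m ⟦ v ⟧ _
  xor≤boundary {true}  {false} b≤b _ = s≤s z≤n
  xor≤boundary {true}  {true}  b≤b _ = z≤n

  not-signEq : ∀ s t → not (signEq s t) ≡ bit s xor bit t
  not-signEq Sign.+ Sign.+ = refl
  not-signEq Sign.+ Sign.- = refl
  not-signEq Sign.- Sign.+ = refl
  not-signEq Sign.- Sign.- = refl

  ∑ : {A : Set} → List A → (A → ℕ) → ℕ
  ∑ []       h = 0
  ∑ (x ∷ xs) h = h x + ∑ xs h

  syntax ∑ xs (λ x → e) = ∑[ x ∈ xs ] e

  module _ {A : Set} where

    ∑-cong : ∀ (xs : List A) {h k : A → ℕ} → (∀ x → h x ≡ k x) → ∑ xs h ≡ ∑ xs k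
    ∑-cong []       h≗k = refl
    ∑-cong (x ∷ xs) h≗k = cong₂ _+_ (h≗k x) (∑-cong xs h≗k)

    ∑-mono-≤ : ∀ (xs : List A) {h k : A → ℕ} → (∀ x → h x ≤ k x) → ∑ xs h ≤ ∑ xs k
    ∑-mono-≤ []       h≤k = z≤n
    ∑-mono-≤ (x ∷ xs) h≤k = ℕ.+-mono-≤ (h≤k x) (∑-mono-≤ xs h≤k)

    ∑-zero : ∀ (xs : List A) → ∑[ x ∈ xs ] 0 ≡ 0
    ∑-zero []       = refl
    ∑-zero (x ∷ xs) = ∑-zero xs

    ∑-distrib-+ : ∀ (xs : List A) (h k : A → ℕ) → ∑[ x ∈ xs ] (h x + k x) ≡ ∑ xs h + ∑ xs k
    ∑-distrib-+ []       h k = refl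
    ∑-distrib-+ (x ∷ xs) h k rewrite ∑-distrib-+ xs h k = +-interchange (h x) (k x) (∑ xs h) (∑ xs k)

    ∑-*ˡ : ∀ (xs : List A) c (h : A → ℕ) → ∑[ x ∈ xs ] (c * h x) ≡ c * ∑ xs h
    ∑-*ˡ []       c h = sym (ℕ.*-zeroʳ c)
    ∑-*ˡ (x ∷ xs) c h rewrite ∑-*ˡ xs c h = sym (ℕ.*-distribˡ-+ c (h x) (∑ xs h))

    ∑-*ʳ : ∀ (xs : List A) c (h : A → ℕ) → ∑[ x ∈ xs ] (h x * c) ≡ ∑ xs h * c
    ∑-*ʳ []       c h = refl
    ∑-*ʳ (x ∷ xs) c h rewrite ∑-*ʳ xs c h = sym (ℕ.*-distribʳ-+ c (h x) (∑ xs h))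

    ∑-++ : ∀ (xs ys : List A) (h : A → ℕ) → ∑ (xs ++ ys) h ≡ ∑ xs h + ∑ ys h
    ∑-++ []       ys h = refl
    ∑-++ (x ∷ xs) ys h rewrite ∑-++ xs ys h = sym (ℕ.+-assoc (h x) _ _)

    ∑-filter : ∀ (xs : List A) {P : A → Set} (P? : ∀ x → Dec (P x)) (h : A → ℕ) →
               ∑ (filter P? xs) h ≡ ∑[ x ∈ xs ] (⟦ does (P? x) ⟧ * h x)
    ∑-filter []       P? h = refl
    ∑-filter (x ∷ xs) P? h with does (P? x)
    ... | true  = cong₂ _+_ (sym (ℕ.+-identityʳ (h x))) (∑-filter xs P? h)
    ... | false = ∑-filter xs P? h

    length≡∑1 : ∀ (xs : List A) → length xs ≡ ∑[ x ∈ xs ] 1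
    length≡∑1 []       = refl
    length≡∑1 (x ∷ xs) = cong suc (length≡∑1 xs)

  module _ {A B : Set} where

    ∑-map : ∀ (xs : List A) (f : A → B) (h : B → ℕ) → ∑ (map f xs) h ≡ ∑[ x ∈ xs ] h (f x)
    ∑-map []       f h = refl
    ∑-map (x ∷ xs) f h = cong (h (f x) +_) (∑-map xs f h)

    ∑-concatMap : ∀ (xs : List A) (f : A → List B) (h : B → ℕ) →
                  ∑ (concatMap f xs) h ≡ ∑[ x ∈ xs ] ∑ (f x) h
    ∑-concatMap []       f h = refl
    ∑-concatMap (x ∷ xs) f h =
      trans (∑-++ (f x) (concat (map f xs)) h) (cong (∑ (f x) h +_) (∑-concatMap xs f h))

    ∑-comm : ∀ (xs : List A) (ys : List B) (h : A → B → ℕ) →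
             ∑[ x ∈ xs ] ∑[ y ∈ ys ] h x y ≡ ∑[ y ∈ ys ] ∑[ x ∈ xs ] h x y
    ∑-comm []       ys h = sym (∑-zero ys)
    ∑-comm (x ∷ xs) ys h rewrite ∑-comm xs ys h = sym (∑-distrib-+ ys (h x) (λ y → ∑[ x ∈ xs ] h x y))

  ∑-allFin-suc : ∀ n (h : Fin (suc n) → ℕ) → ∑ (allFin (suc n)) h ≡ h fzero + ∑[ a ∈ allFin n ] h (fsuc a)
  ∑-allFin-suc n h = cong (h fzero +_) (trans (cong (λ as → ∑ as h) (sym (map-tabulate (λ a → a) fsuc))) (∑-map (allFin n) fsuc h))

  <-exclusive : ∀ a b → ⟦ does (a ℕ.<? b) ⟧ + ⟦ does (b ℕ.<? a) ⟧ ≤ 1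
  <-exclusive a b with a ℕ.<ᵇ b in a<b | b ℕ.<ᵇ a in b<a
  ... | true  | true  = ⊥-elim (ℕ.<-asym (ℕ.<ᵇ⇒< a b (subst Bool.T (sym a<b) _)) (ℕ.<ᵇ⇒< b a (subst Bool.T (sym b<a) _)))
  ... | true  | false = ℕ.≤-refl
  ... | false | true  = ℕ.≤-refl
  ... | false | false = z≤n

  ∑-pairs : ∀ n (G : Fin n × Fin n → ℕ) →
    ∑ (pairs n) G ≡ ∑[ i ∈ allFin n ] ∑[ j ∈ allFin n ] (⟦ does (toℕ i ℕ.<? toℕ j) ⟧ * G (i , j))
  ∑-pairs n G = trans (∑-concatMap (allFin n) _ G) (∑-cong (allFin n) λ i →
    trans (∑-map (filter (λ j → toℕ i ℕ.<? toℕ j) (allFin n)) (i ,_) G)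
          (∑-filter (allFin n) (λ j → toℕ i ℕ.<? toℕ j) (λ j → G (i , j))))

  ∑-pairs-symmetrised≤ : ∀ n (F : Fin n → Fin n → ℕ) →
    ∑[ p ∈ pairs n ] (F (proj₁ p) (proj₂ p) + F (proj₂ p) (proj₁ p)) ≤ ∑[ i ∈ allFin n ] ∑[ j ∈ allFin n ] F i j
  ∑-pairs-symmetrised≤ n F = begin
    ∑[ p ∈ pairs n ] (F (proj₁ p) (proj₂ p) + F (proj₂ p) (proj₁ p))
      ≡⟨ ∑-pairs n _ ⟩
    ∑[ i ∈ fins ] ∑[ j ∈ fins ] (lt i j * (F i j + F j i))
      ≡⟨ ∑-cong fins (λ i → trans (∑-cong fins (λ j → ℕ.*-distribˡ-+ (lt i j) _ _)) (∑-distrib-+ fins _ _)) ⟩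
    ∑[ i ∈ fins ] (∑[ j ∈ fins ] (lt i j * F i j) + ∑[ j ∈ fins ] (lt i j * F j i))
      ≡⟨ ∑-distrib-+ fins _ _ ⟩
    ∑[ i ∈ fins ] ∑[ j ∈ fins ] (lt i j * F i j) + ∑[ i ∈ fins ] ∑[ j ∈ fins ] (lt i j * F j i)
      ≡⟨ cong (∑[ i ∈ fins ] ∑[ j ∈ fins ] (lt i j * F i j) +_) (∑-comm fins fins (λ i j → lt i j * F j i)) ⟩
    ∑[ i ∈ fins ] ∑[ j ∈ fins ] (lt i j * F i j) + ∑[ i ∈ fins ] ∑[ j ∈ fins ] (lt j i * F i j)
      ≡⟨ ∑-distrib-+ fins _ _ ⟨
    ∑[ i ∈ fins ] (∑[ j ∈ fins ] (lt i j * F i j) + ∑[ j ∈ fins ] (lt j i * F i j))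
      ≡⟨ ∑-cong fins (λ i → trans (∑-cong fins (λ j → ℕ.*-distribʳ-+ (F i j) (lt i j) (lt j i))) (∑-distrib-+ fins _ _)) ⟨
    ∑[ i ∈ fins ] ∑[ j ∈ fins ] ((lt i j + lt j i) * F i j)
      ≤⟨ ∑-mono-≤ fins (λ i → ∑-mono-≤ fins (λ j → ℕ.≤-trans (ℕ.*-monoˡ-≤ (F i j) (<-exclusive (toℕ i) (toℕ j)))
                                                             (ℕ.≤-reflexive (ℕ.*-identityˡ (F i j))))) ⟩
    ∑[ i ∈ fins ] ∑[ j ∈ fins ] F i j ∎
    where
    open ℕ.≤-Reasoning
    fins = allFin n
    lt : Fin n → Fin n → ℕ
    lt i j = ⟦ does (toℕ i ℕ.<? toℕ j) ⟧

  weight≡∑ : ∀ {n} (x : Cube n) → ∑[ a ∈ allFin n ] ⟦ lookup x a ⟧ ≡ weight x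
  weight≡∑ []ᵥ                = refl
  weight≡∑ {suc n} (true ∷ᵥ x)  = trans (∑-allFin-suc n (λ a → ⟦ lookup (true ∷ᵥ x) a ⟧)) (cong suc (weight≡∑ x))
  weight≡∑ {suc n} (false ∷ᵥ x) = trans (∑-allFin-suc n (λ a → ⟦ lookup (false ∷ᵥ x) a ⟧)) (weight≡∑ x)

  zeros+weight : ∀ {n} (x : Cube n) → ∑[ a ∈ allFin n ] ⟦ not (lookup x a) ⟧ + weight x ≡ n
  zeros+weight []ᵥ = refl
  zeros+weight {suc n} (true ∷ᵥ x) =
    trans (cong (_+ suc (weight x)) (∑-allFin-suc n (λ a → ⟦ not (lookup (true ∷ᵥ x) a) ⟧)))
          (trans (ℕ.+-suc _ (weight x)) (cong suc (zeros+weight x)))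
  zeros+weight {suc n} (false ∷ᵥ x) =
    trans (cong (_+ weight x) (∑-allFin-suc n (λ a → ⟦ not (lookup (false ∷ᵥ x) a) ⟧))) (cong suc (zeros+weight x))

  zeros≡∑ : ∀ {n} (x : Cube n) → ∑[ a ∈ allFin n ] ⟦ not (lookup x a) ⟧ ≡ n ∸ weight x
  zeros≡∑ x = trans (sym (ℕ.m+n∸n≡m _ (weight x))) (cong (_∸ weight x) (zeros+weight x))

  -- Slices of the cube

  sliceSum : (n r : ℕ) → (Cube n → ℕ) → ℕ
  sliceSum zero    zero    h = h []ᵥ
  sliceSum zero    (suc r) h = 0
  sliceSum (suc n) zero    h = sliceSum n zero (λ x → h (false ∷ᵥ x))
  sliceSum (suc n) (suc r) h = sliceSum n (suc r) (λ x → h (false ∷ᵥ x)) + sliceSum n r (λ x → h (true ∷ᵥ x))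

  sliceSum-mono-≤ : ∀ n r {h k : Cube n → ℕ} → (∀ x → weight x ≡ r → h x ≤ k x) → sliceSum n r h ≤ sliceSum n r k
  sliceSum-mono-≤ zero    zero    h≤k = h≤k []ᵥ refl
  sliceSum-mono-≤ zero    (suc r) h≤k = z≤n
  sliceSum-mono-≤ (suc n) zero    h≤k = sliceSum-mono-≤ n zero (λ x → h≤k (false ∷ᵥ x))
  sliceSum-mono-≤ (suc n) (suc r) h≤k =
    ℕ.+-mono-≤ (sliceSum-mono-≤ n (suc r) (λ x → h≤k (false ∷ᵥ x)))
               (sliceSum-mono-≤ n r (λ x w → h≤k (true ∷ᵥ x) (cong suc w)))

  sliceSum-cong : ∀ n r {h k : Cube n → ℕ} → (∀ x → weight x ≡ r → h x ≡ k x) → sliceSum n r h ≡ sliceSum n r k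
  sliceSum-cong n r h≡k =
    ℕ.≤-antisym (sliceSum-mono-≤ n r (λ x w → ℕ.≤-reflexive (h≡k x w)))
                (sliceSum-mono-≤ n r (λ x w → ℕ.≤-reflexive (sym (h≡k x w))))

  sliceSum-zero : ∀ n r → sliceSum n r (λ _ → 0) ≡ 0
  sliceSum-zero zero    zero    = refl
  sliceSum-zero zero    (suc r) = refl
  sliceSum-zero (suc n) zero    = sliceSum-zero n zero
  sliceSum-zero (suc n) (suc r) = cong₂ _+_ (sliceSum-zero n (suc r)) (sliceSum-zero n r)

  sliceSum-distrib-+ : ∀ n r (h k : Cube n → ℕ) → sliceSum n r (λ x → h x + k x) ≡ sliceSum n r h + sliceSum n r k
  sliceSum-distrib-+ zero    zero    h k = refl
  sliceSum-distrib-+ zero    (suc r) h k = refl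
  sliceSum-distrib-+ (suc n) zero    h k = sliceSum-distrib-+ n zero _ _
  sliceSum-distrib-+ (suc n) (suc r) h k
    rewrite sliceSum-distrib-+ n (suc r) (λ x → h (false ∷ᵥ x)) (λ x → k (false ∷ᵥ x))
          | sliceSum-distrib-+ n r (λ x → h (true ∷ᵥ x)) (λ x → k (true ∷ᵥ x)) =
    +-interchange (sliceSum n (suc r) (λ x → h (false ∷ᵥ x))) (sliceSum n (suc r) (λ x → k (false ∷ᵥ x)))
                  (sliceSum n r (λ x → h (true ∷ᵥ x))) (sliceSum n r (λ x → k (true ∷ᵥ x)))

  sliceSum-*ˡ : ∀ n r c (h : Cube n → ℕ) → sliceSum n r (λ x → c * h x) ≡ c * sliceSum n r h
  sliceSum-*ˡ zero    zero    c h = refl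
  sliceSum-*ˡ zero    (suc r) c h = sym (ℕ.*-zeroʳ c)
  sliceSum-*ˡ (suc n) zero    c h = sliceSum-*ˡ n zero c _
  sliceSum-*ˡ (suc n) (suc r) c h
    rewrite sliceSum-*ˡ n (suc r) c (λ x → h (false ∷ᵥ x)) | sliceSum-*ˡ n r c (λ x → h (true ∷ᵥ x)) =
    sym (ℕ.*-distribˡ-+ c _ _)

  sliceSum-weight-*ˡ : ∀ n r (c : ℕ → ℕ) (h : Cube n → ℕ) → sliceSum n r (λ x → c (weight x) * h x) ≡ c r * sliceSum n r h
  sliceSum-weight-*ˡ n r c h = trans (sliceSum-cong n r (λ x w → cong (λ t → c t * h x) w)) (sliceSum-*ˡ n r (c r) h)

  sliceSum-∑ : ∀ {A : Set} n r (xs : List A) (h : A → Cube n → ℕ) →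
               sliceSum n r (λ x → ∑[ a ∈ xs ] h a x) ≡ ∑[ a ∈ xs ] sliceSum n r (h a)
  sliceSum-∑ n r []       h = sliceSum-zero n r
  sliceSum-∑ n r (a ∷ xs) h = trans (sliceSum-distrib-+ n r (h a) _) (cong (sliceSum n r (h a) +_) (sliceSum-∑ n r xs h))

  ∑-allCubes : ∀ n r (h : Cube n → ℕ) → ∑[ x ∈ allCubes n ] (⟦ does (weight x ℕ.≟ r) ⟧ * h x) ≡ sliceSum n r h
  ∑-allCubes zero zero    h = trans (ℕ.+-identityʳ _) (ℕ.+-identityʳ _)
  ∑-allCubes zero (suc r) h = refl
  ∑-allCubes (suc n) r h = trans (∑-concatMap (allCubes n) (λ x → (false ∷ᵥ x) ∷ (true ∷ᵥ x) ∷ []) _) (split r)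
    where
    χ : ℕ → Cube (suc n) → ℕ
    χ r x = ⟦ does (weight x ℕ.≟ r) ⟧ * h x
    split : ∀ r → ∑[ x ∈ allCubes n ] (χ r (false ∷ᵥ x) + (χ r (true ∷ᵥ x) + 0)) ≡ sliceSum (suc n) r h
    split zero    = trans (∑-cong (allCubes n) (λ x → ℕ.+-identityʳ _)) (∑-allCubes n zero _)
    split (suc r) =
      trans (∑-cong (allCubes n) (λ x → cong (χ (suc r) (false ∷ᵥ x) +_) (ℕ.+-identityʳ _)))
            (trans (∑-distrib-+ (allCubes n) _ _) (cong₂ _+_ (∑-allCubes n (suc r) _) (∑-allCubes n r _)))

  ∑-slice : ∀ n r (h : Cube n → ℕ) → ∑ (slice n r) h ≡ sliceSum n r h
  ∑-slice n r h = trans (∑-filter (allCubes n) (λ x → weight x ℕ.≟ r) h) (∑-allCubes n r h)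

  sliceSum-1-positive : ∀ n r → r ≤ n → 1 ≤ sliceSum n r (λ _ → 1)
  sliceSum-1-positive zero    zero    _         = s≤s z≤n
  sliceSum-1-positive (suc n) zero    _         = sliceSum-1-positive n zero z≤n
  sliceSum-1-positive (suc n) (suc r) (s≤s r≤n) = ℕ.≤-trans (sliceSum-1-positive n r r≤n) (ℕ.m≤n+m _ _)

  sliceSum-lookup-zero : ∀ n a (h : Cube n → ℕ) → sliceSum n 0 (λ u → ⟦ lookup u a ⟧ * h u) ≡ 0
  sliceSum-lookup-zero (suc n) fzero    h = sliceSum-zero n 0
  sliceSum-lookup-zero (suc n) (fsuc a) h = sliceSum-lookup-zero n a (λ u → h (false ∷ᵥ u))

  -- x ↦ x [ a ]≔ true is a bijection from the x in slice r with x_a = 0 onto the u in slice (r+1) with u_a = 1.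
  sliceSum-raise : ∀ n r a (h : Cube n → ℕ) →
    sliceSum n r (λ x → ⟦ not (lookup x a) ⟧ * h (x [ a ]≔ true)) ≡ sliceSum n (suc r) (λ u → ⟦ lookup u a ⟧ * h u)
  sliceSum-raise (suc n) zero fzero h = cong (_+ sliceSum n 0 (λ x → 1 * h (true ∷ᵥ x))) (sym (sliceSum-zero n 1))
  sliceSum-raise (suc n) (suc r) fzero h rewrite sliceSum-zero n r | sliceSum-zero n (suc (suc r)) = ℕ.+-identityʳ _
  sliceSum-raise (suc n) zero (fsuc a) h =
    trans (sliceSum-raise n zero a (λ u → h (false ∷ᵥ u)))
          (sym (trans (cong (sliceSum n 1 (λ u → ⟦ lookup u a ⟧ * h (false ∷ᵥ u)) +_)
                            (sliceSum-lookup-zero n a (λ u → h (true ∷ᵥ u))))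
                      (ℕ.+-identityʳ _)))
  sliceSum-raise (suc n) (suc r) (fsuc a) h =
    cong₂ _+_ (sliceSum-raise n (suc r) a (λ u → h (false ∷ᵥ u))) (sliceSum-raise n r a (λ u → h (true ∷ᵥ u)))

  -- Double counting the edges between slices r and r + 1.
  sliceSum-upEdges : ∀ n r (h : Cube n → ℕ) →
    sliceSum n r (λ x → ∑[ a ∈ allFin n ] (⟦ not (lookup x a) ⟧ * h (x [ a ]≔ true))) ≡ suc r * sliceSum n (suc r) h
  sliceSum-upEdges n r h = begin
    sliceSum n r (λ x → ∑[ a ∈ allFin n ] (⟦ not (lookup x a) ⟧ * h (x [ a ]≔ true)))
      ≡⟨ sliceSum-∑ n r (allFin n) _ ⟩
    ∑[ a ∈ allFin n ] sliceSum n r (λ x → ⟦ not (lookup x a) ⟧ * h (x [ a ]≔ true))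
      ≡⟨ ∑-cong (allFin n) (λ a → sliceSum-raise n r a h) ⟩
    ∑[ a ∈ allFin n ] sliceSum n (suc r) (λ u → ⟦ lookup u a ⟧ * h u)
      ≡⟨ sliceSum-∑ n (suc r) (allFin n) (λ a u → ⟦ lookup u a ⟧ * h u) ⟨
    sliceSum n (suc r) (λ u → ∑[ a ∈ allFin n ] (⟦ lookup u a ⟧ * h u))
      ≡⟨ sliceSum-cong n (suc r) (λ u w → trans (∑-*ʳ (allFin n) (h u) (λ a → ⟦ lookup u a ⟧))
                                                (cong (_* h u) (trans (weight≡∑ u) w))) ⟩
    sliceSum n (suc r) (λ u → suc r * h u)
      ≡⟨ sliceSum-*ˡ n (suc r) (suc r) h ⟩
    suc r * sliceSum n (suc r) h ∎
    where open ≡-Reasoning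

  sliceSum-upZeros : ∀ n r (h : Cube n → ℕ) →
    sliceSum n r (λ x → ∑[ a ∈ allFin n ] (⟦ not (lookup x a) ⟧ * h x)) ≡ (n ∸ r) * sliceSum n r h
  sliceSum-upZeros n r h = trans (sliceSum-cong n r zeros) (sliceSum-*ˡ n r (n ∸ r) h)
    where
    zeros : ∀ x → weight x ≡ r → ∑[ a ∈ allFin n ] (⟦ not (lookup x a) ⟧ * h x) ≡ (n ∸ r) * h x
    zeros x w = trans (∑-*ʳ (allFin n) (h x) _) (cong (λ t → t * h x) (trans (zeros≡∑ x) (cong (n ∸_) w)))

  sliceSize : ℕ → ℕ → ℕ
  sliceSize n r = sliceSum n r (λ _ → 1)

  sliceSize-step : ∀ n r → (n ∸ r) * sliceSize n r ≡ suc r * sliceSize n (suc r)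
  sliceSize-step n r = trans (sym (sliceSum-upZeros n r (λ _ → 1))) (sliceSum-upEdges n r (λ _ → 1))

  -- Transpositions of coordinates

  ⪯-lookup : ∀ {n} {x y : Cube n} → (∀ l → lookup x l Bool.≤ lookup y l) → x ⪯ y
  ⪯-lookup {x = []ᵥ}     {[]ᵥ}     x≤y = Pointwise.[]
  ⪯-lookup {x = _ ∷ᵥ _} {_ ∷ᵥ _} x≤y = x≤y fzero Pointwise.∷ ⪯-lookup (λ l → x≤y (fsuc l))

  ⪯-raise : ∀ {n} (x : Cube n) a → x ⪯ (x [ a ]≔ true)
  ⪯-raise x a = ⪯-lookup go
    where
    go : ∀ l → lookup x l Bool.≤ lookup (x [ a ]≔ true) l
    go l with l ≟ a
    ... | yes refl = subst (lookup x l Bool.≤_) (sym (Vecₚ.lookup∘update l x true)) (≤-maximum _)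
    ... | no l≢a   = ≤-reflexiveᵇ (sym (Vecₚ.lookup∘update′ l≢a x true))

  lower∘raise : ∀ {n} (x : Cube n) a → lookup x a ≡ false → (x [ a ]≔ true) [ a ]≔ false ≡ x
  lower∘raise x a xₐ≡0 = trans (Vecₚ.[]≔-idempotent x a) (trans (cong (x [ a ]≔_) (sym xₐ≡0)) (Vecₚ.[]≔-lookup x a))

  module _ {n : ℕ} (i j : Fin n) (x : Cube n) where

    swapped : Fin n → Bool
    swapped l = if does (l ≟ i) then lookup x j else if does (l ≟ j) then lookup x i else lookup x l

    lookup-swap : ∀ l → lookup (swap i j x) l ≡ swapped l
    lookup-swap l = Vecₚ.lookup∘tabulate swapped l

    swap-id : lookup x i ≡ lookup x j → swap i j x ≡ x
    swap-id xᵢ≡xⱼ = trans (Vecₚ.tabulate-cong go) (Vecₚ.tabulate∘lookup x)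
      where
      go : ∀ l → swapped l ≡ lookup x l
      go l with l ≟ i | l ≟ j
      ... | yes refl | _        = sym xᵢ≡xⱼ
      ... | no _     | yes refl = xᵢ≡xⱼ
      ... | no _     | no _     = refl

    swap≤raise : lookup x i ≡ false → swap i j x ⪯ (x [ i ]≔ true)
    swap≤raise xᵢ≡0 = ⪯-lookup λ l → subst (Bool._≤ lookup (x [ i ]≔ true) l) (sym (lookup-swap l)) (go l)
      where
      go : ∀ l → swapped l Bool.≤ lookup (x [ i ]≔ true) l
      go l with l ≟ i | l ≟ j
      ... | yes refl | _     = subst (lookup x j Bool.≤_) (sym (Vecₚ.lookup∘update l x true)) (≤-maximum _)
      ... | no _     | yes _ = subst (Bool._≤ lookup (x [ i ]≔ true) l) (sym xᵢ≡0) (≤-minimum _)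
      ... | no l≢i   | no _  = ≤-reflexiveᵇ (sym (Vecₚ.lookup∘update′ l≢i x true))

    lower≤swap : lookup x j ≡ true → (x [ j ]≔ false) ⪯ swap i j x
    lower≤swap xⱼ≡1 = ⪯-lookup λ l → subst (lookup (x [ j ]≔ false) l Bool.≤_) (sym (lookup-swap l)) (go l)
      where
      go : ∀ l → lookup (x [ j ]≔ false) l Bool.≤ swapped l
      go l with l ≟ i | l ≟ j
      ... | yes _ | _        = subst (lookup (x [ j ]≔ false) l Bool.≤_) (sym xⱼ≡1) (≤-maximum _)
      ... | no _  | yes refl = subst (Bool._≤ lookup x i) (sym (Vecₚ.lookup∘update l x false)) (≤-minimum _)
      ... | no _  | no l≢j   = ≤-reflexiveᵇ (Vecₚ.lookup∘update′ l≢j x false)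

  swap-comm : ∀ {n} (i j : Fin n) (x : Cube n) → swap i j x ≡ swap j i x
  swap-comm i j x = Vecₚ.tabulate-cong go
    where
    go : ∀ l → swapped i j x l ≡ swapped j i x l
    go l with l ≟ i | l ≟ j
    ... | yes refl | yes refl = refl
    ... | yes _    | no _     = refl
    ... | no _     | yes _    = refl
    ... | no _     | no _     = refl

  -- Boundary edges of a Boolean function

  module Boundary {n : ℕ} (g : Cube n → Bool) where

    rises falls : Fin n → Cube n → Bool
    rises a x = not (g x) ∧ g (x [ a ]≔ true)
    falls a x = not (g (x [ a ]≔ false)) ∧ g x

    upEdge downEdge : Fin n → Cube n → Bool
    upEdge   a x = not (lookup x a) ∧ rises a x
    downEdge a x = lookup x a ∧ falls a x

    upDegree downDegree : Cube n → ℕ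
    upDegree   x = ∑[ a ∈ allFin n ] ⟦ upEdge a x ⟧
    downDegree x = ∑[ a ∈ allFin n ] ⟦ downEdge a x ⟧

    edgesAbove edgesBelow positives : ℕ → ℕ
    edgesAbove r = sliceSum n r upDegree
    edgesBelow r = sliceSum n r downDegree
    positives  r = sliceSum n r (λ x → ⟦ g x ⟧)

    chargedEdges : ℕ → ℕ
    chargedEdges r = r * edgesAbove r + (n ∸ r) * edgesBelow r

    positives≤sliceSize : ∀ r → positives r ≤ sliceSize n r
    positives≤sliceSize r = sliceSum-mono-≤ n r (λ x _ → ⟦⟧≤1 (g x))

    edgesBelow-zero : edgesBelow 0 ≡ 0
    edgesBelow-zero = begin
      edgesBelow 0
        ≡⟨ sliceSum-∑ n 0 (allFin n) (λ a u → ⟦ downEdge a u ⟧) ⟩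
      ∑[ a ∈ allFin n ] sliceSum n 0 (λ u → ⟦ downEdge a u ⟧)
        ≡⟨ ∑-cong (allFin n) (λ a → sliceSum-cong n 0 (λ u _ → ⟦∧⟧ (lookup u a) (falls a u))) ⟩
      ∑[ a ∈ allFin n ] sliceSum n 0 (λ u → ⟦ lookup u a ⟧ * ⟦ falls a u ⟧)
        ≡⟨ ∑-cong (allFin n) (λ a → sliceSum-lookup-zero n a (λ u → ⟦ falls a u ⟧)) ⟩
      ∑[ a ∈ allFin n ] 0
        ≡⟨ ∑-zero (allFin n) ⟩
      0 ∎
      where open ≡-Reasoning

    edgesBelow-suc : ∀ r → edgesBelow (suc r) ≡ edgesAbove r
    edgesBelow-suc r = begin
      sliceSum n (suc r) (λ u → ∑[ a ∈ allFin n ] ⟦ downEdge a u ⟧)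
        ≡⟨ sliceSum-∑ n (suc r) (allFin n) (λ a u → ⟦ downEdge a u ⟧) ⟩
      ∑[ a ∈ allFin n ] sliceSum n (suc r) (λ u → ⟦ downEdge a u ⟧)
        ≡⟨ ∑-cong (allFin n) (λ a → sliceSum-cong n (suc r) (λ u _ → ⟦∧⟧ (lookup u a) (falls a u))) ⟩
      ∑[ a ∈ allFin n ] sliceSum n (suc r) (λ u → ⟦ lookup u a ⟧ * ⟦ falls a u ⟧)
        ≡⟨ ∑-cong (allFin n) (λ a → sliceSum-raise n r a (λ u → ⟦ falls a u ⟧)) ⟨
      ∑[ a ∈ allFin n ] sliceSum n r (λ x → ⟦ not (lookup x a) ⟧ * ⟦ falls a (x [ a ]≔ true) ⟧)
        ≡⟨ ∑-cong (allFin n) (λ a → sliceSum-cong n r (λ x _ → falls∘raise a x)) ⟩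
      ∑[ a ∈ allFin n ] sliceSum n r (λ x → ⟦ upEdge a x ⟧)
        ≡⟨ sliceSum-∑ n r (allFin n) (λ a x → ⟦ upEdge a x ⟧) ⟨
      edgesAbove r ∎
      where
      open ≡-Reasoning
      falls∘raise : ∀ a x → ⟦ not (lookup x a) ⟧ * ⟦ falls a (x [ a ]≔ true) ⟧ ≡ ⟦ upEdge a x ⟧
      falls∘raise a x with lookup x a in xₐ
      ... | true  = refl
      ... | false = trans (ℕ.+-identityʳ _) (cong (λ y → ⟦ not (g y) ∧ g (x [ a ]≔ true) ⟧) (lower∘raise x a xₐ))

  module MonotoneBoundary {n : ℕ} (g : Cube n → Bool) (g-mono : Monotone g) where
    open Boundary g

    edgesAbove+positives : ∀ r → edgesAbove r + (n ∸ r) * positives r ≡ suc r * positives (suc r)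
    edgesAbove+positives r = begin
      edgesAbove r + (n ∸ r) * positives r
        ≡⟨ cong (edgesAbove r +_) (sliceSum-upZeros n r (λ x → ⟦ g x ⟧)) ⟨
      edgesAbove r + sliceSum n r (λ x → ∑[ a ∈ allFin n ] (⟦ not (lookup x a) ⟧ * ⟦ g x ⟧))
        ≡⟨ sliceSum-distrib-+ n r upDegree _ ⟨
      sliceSum n r (λ x → upDegree x + ∑[ a ∈ allFin n ] (⟦ not (lookup x a) ⟧ * ⟦ g x ⟧))
        ≡⟨ sliceSum-cong n r (λ x _ → sym (∑-distrib-+ (allFin n) (λ a → ⟦ upEdge a x ⟧) _)) ⟩
      sliceSum n r (λ x → ∑[ a ∈ allFin n ] (⟦ upEdge a x ⟧ + ⟦ not (lookup x a) ⟧ * ⟦ g x ⟧))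
        ≡⟨ sliceSum-cong n r (λ x _ → ∑-cong (allFin n) (λ a → split a x)) ⟨
      sliceSum n r (λ x → ∑[ a ∈ allFin n ] (⟦ not (lookup x a) ⟧ * ⟦ g (x [ a ]≔ true) ⟧))
        ≡⟨ sliceSum-upEdges n r (λ x → ⟦ g x ⟧) ⟩
      suc r * positives (suc r) ∎
      where
      open ≡-Reasoning
      split : ∀ a x → ⟦ not (lookup x a) ⟧ * ⟦ g (x [ a ]≔ true) ⟧ ≡ ⟦ upEdge a x ⟧ + ⟦ not (lookup x a) ⟧ * ⟦ g x ⟧
      split a x = trans (⟦∧⟧-split (not (lookup x a)) (g-mono x (x [ a ]≔ true) (⪯-raise x a)))
                        (cong (⟦ upEdge a x ⟧ +_) (ℕ.*-comm ⟦ g x ⟧ _))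

    charge : Fin n → Fin n → Cube n → ℕ
    charge i j x = ⟦ lookup x j ∧ upEdge i x ⟧ + ⟦ not (lookup x i) ∧ downEdge j x ⟧

    flip≤charge : ∀ i j x → lookup x i ≡ false → lookup x j ≡ true → ⟦ g (swap i j x) xor g x ⟧ ≤ charge i j x
    flip≤charge i j x xᵢ≡0 xⱼ≡1 =
      subst (⟦ g (swap i j x) xor g x ⟧ ≤_)
            (cong₂ (λ xᵢ xⱼ → ⟦ xⱼ ∧ (not xᵢ ∧ rises i x) ⟧ + ⟦ not xᵢ ∧ (xⱼ ∧ falls j x) ⟧)
                   (sym xᵢ≡0) (sym xⱼ≡1))
            (xor≤boundary (g-mono _ _ (swap≤raise i j x xᵢ≡0)) (g-mono _ _ (lower≤swap i j x xⱼ≡1)))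

    no-flip : ∀ i j x → lookup x i ≡ lookup x j → ⟦ g (swap i j x) xor g x ⟧ ≡ 0
    no-flip i j x xᵢ≡xⱼ rewrite swap-id i j x xᵢ≡xⱼ | xor-same (g x) = refl

    flip≤charges : ∀ i j x → ⟦ g (swap i j x) xor g x ⟧ ≤ charge i j x + charge j i x
    flip≤charges i j x = by-coordinates (lookup x i) (lookup x j) refl refl
      where
      by-coordinates : ∀ a b → lookup x i ≡ a → lookup x j ≡ b → ⟦ g (swap i j x) xor g x ⟧ ≤ charge i j x + charge j i x
      by-coordinates false true  xᵢ xⱼ = ℕ.≤-trans (flip≤charge i j x xᵢ xⱼ) (ℕ.m≤m+n (charge i j x) (charge j i x))
      by-coordinates true  false xᵢ xⱼ = subst (λ y → ⟦ g y xor g x ⟧ ≤ charge i j x + charge j i x) (swap-comm j i x)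
                                               (ℕ.≤-trans (flip≤charge j i x xⱼ xᵢ) (ℕ.m≤n+m (charge j i x) (charge i j x)))
      by-coordinates false false xᵢ xⱼ = subst (_≤ charge i j x + charge j i x) (sym (no-flip i j x (trans xᵢ (sym xⱼ)))) z≤n
      by-coordinates true  true  xᵢ xⱼ = subst (_≤ charge i j x + charge j i x) (sym (no-flip i j x (trans xᵢ (sym xⱼ)))) z≤n

    ∑∑-charge : ∀ x →
      ∑[ i ∈ allFin n ] ∑[ j ∈ allFin n ] charge i j x ≡ weight x * upDegree x + (n ∸ weight x) * downDegree x
    ∑∑-charge x = begin
      ∑[ i ∈ allFin n ] ∑[ j ∈ allFin n ] charge i j x
        ≡⟨ ∑-cong (allFin n) (λ i → ∑-distrib-+ (allFin n) (up i) (down i)) ⟩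
      ∑[ i ∈ allFin n ] (∑[ j ∈ allFin n ] up i j + ∑[ j ∈ allFin n ] down i j)
        ≡⟨ ∑-distrib-+ (allFin n) _ _ ⟩
      ∑[ i ∈ allFin n ] ∑[ j ∈ allFin n ] up i j + ∑[ i ∈ allFin n ] ∑[ j ∈ allFin n ] down i j
        ≡⟨ cong₂ _+_ ∑∑-up (trans (∑-comm (allFin n) (allFin n) down) ∑∑-down) ⟩
      weight x * upDegree x + (n ∸ weight x) * downDegree x ∎
      where
      open ≡-Reasoning
      up down : Fin n → Fin n → ℕ
      up   i j = ⟦ lookup x j ∧ upEdge i x ⟧
      down i j = ⟦ not (lookup x i) ∧ downEdge j x ⟧
      ∑∑-up : ∑[ i ∈ allFin n ] ∑[ j ∈ allFin n ] up i j ≡ weight x * upDegree x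
      ∑∑-up = trans (∑-cong (allFin n) λ i →
                      trans (∑-cong (allFin n) (λ j → ⟦∧⟧ (lookup x j) (upEdge i x)))
                            (trans (∑-*ʳ (allFin n) _ _) (cong (_* ⟦ upEdge i x ⟧) (weight≡∑ x))))
                    (∑-*ˡ (allFin n) (weight x) _)
      ∑∑-down : ∑[ j ∈ allFin n ] ∑[ i ∈ allFin n ] down i j ≡ (n ∸ weight x) * downDegree x
      ∑∑-down = trans (∑-cong (allFin n) λ j →
                        trans (∑-cong (allFin n) (λ i → ⟦∧⟧ (not (lookup x i)) (downEdge j x)))
                              (trans (∑-*ʳ (allFin n) _ _) (cong (_* ⟦ downEdge j x ⟧) (zeros≡∑ x))))
                      (∑-*ˡ (allFin n) (n ∸ weight x) _)

    ∑-pairs-flips≤ : ∀ x →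
      ∑[ p ∈ pairs n ] ⟦ g (swap (proj₁ p) (proj₂ p) x) xor g x ⟧ ≤ weight x * upDegree x + (n ∸ weight x) * downDegree x
    ∑-pairs-flips≤ x = begin
      ∑[ p ∈ pairs n ] ⟦ g (swap (proj₁ p) (proj₂ p) x) xor g x ⟧
        ≤⟨ ∑-mono-≤ (pairs n) (λ p → flip≤charges (proj₁ p) (proj₂ p) x) ⟩
      ∑[ p ∈ pairs n ] (charge (proj₁ p) (proj₂ p) x + charge (proj₂ p) (proj₁ p) x)
        ≤⟨ ∑-pairs-symmetrised≤ n (λ i j → charge i j x) ⟩
      ∑[ i ∈ allFin n ] ∑[ j ∈ allFin n ] charge i j x
        ≡⟨ ∑∑-charge x ⟩
      weight x * upDegree x + (n ∸ weight x) * downDegree x ∎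
      where open ℕ.≤-Reasoning

    sliceSum-flips≤ : ∀ r →
      sliceSum n r (λ x → ∑[ p ∈ pairs n ] ⟦ g (swap (proj₁ p) (proj₂ p) x) xor g x ⟧) ≤ chargedEdges r
    sliceSum-flips≤ r = begin
      sliceSum n r (λ x → ∑[ p ∈ pairs n ] ⟦ g (swap (proj₁ p) (proj₂ p) x) xor g x ⟧)
        ≤⟨ sliceSum-mono-≤ n r (λ x _ → ∑-pairs-flips≤ x) ⟩
      sliceSum n r (λ x → weight x * upDegree x + (n ∸ weight x) * downDegree x)
        ≡⟨ sliceSum-distrib-+ n r _ _ ⟩
      sliceSum n r (λ x → weight x * upDegree x) + sliceSum n r (λ x → (n ∸ weight x) * downDegree x)
        ≡⟨ cong₂ _+_ (sliceSum-weight-*ˡ n r (λ w → w) upDegree) (sliceSum-weight-*ˡ n r (n ∸_) downDegree) ⟩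
      r * edgesAbove r + (n ∸ r) * edgesBelow r ∎
      where open ℕ.≤-Reasoning

  xorAll-flip≤ : ∀ {n k} (gs : Vec (Cube n → Bool) k) y x →
    ⟦ xorAll gs y xor xorAll gs x ⟧ ≤ ∑[ g ∈ toList gs ] ⟦ g y xor g x ⟧
  xorAll-flip≤ []ᵥ        y x = z≤n
  xorAll-flip≤ (g ∷ᵥ gs) y x = begin
    ⟦ (g y xor xorAll gs y) xor (g x xor xorAll gs x) ⟧ ≡⟨ cong ⟦_⟧ (xor-interchange (g y) (xorAll gs y) (g x) (xorAll gs x)) ⟩
    ⟦ (g y xor g x) xor (xorAll gs y xor xorAll gs x) ⟧ ≤⟨ ⟦xor⟧≤ (g y xor g x) _ ⟩
    ⟦ g y xor g x ⟧ + ⟦ xorAll gs y xor xorAll gs x ⟧ ≤⟨ ℕ.+-monoʳ-≤ ⟦ g y xor g x ⟧ (xorAll-flip≤ gs y x) ⟩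
    ⟦ g y xor g x ⟧ + ∑[ g ∈ toList gs ] ⟦ g y xor g x ⟧ ∎
    where open ℕ.≤-Reasoning

  ∑-allMonotone-≤ : ∀ {n k} {gs : Vec (Cube n → Bool) k} {h h′ : (Cube n → Bool) → ℕ} → AllMonotone gs →
    (∀ g → Monotone g → h g ≤ h′ g) → ∑ (toList gs) h ≤ ∑ (toList gs) h′
  ∑-allMonotone-≤ []ᵐ              h≤h′ = z≤n
  ∑-allMonotone-≤ (g-mono ∷ᵐ mono) h≤h′ = ℕ.+-mono-≤ (h≤h′ _ g-mono) (∑-allMonotone-≤ mono h≤h′)

  length-filter-T? : ∀ {A : Set} (xs : List A) (b : A → Bool) → length (filter (λ x → Bool.T? (b x)) xs) ≡ ∑[ x ∈ xs ] ⟦ b x ⟧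
  length-filter-T? xs b = trans (length≡∑1 (filter (λ x → Bool.T? (b x)) xs))
                                (trans (∑-filter xs (λ x → Bool.T? (b x)) (λ _ → 1)) (∑-cong xs (λ x → ℕ.*-identityʳ ⟦ b x ⟧)))

  flips : ∀ {n} → (Cube n → Sign) → ℕ → Fin n × Fin n → ℕ
  flips {n} f r p = length (filter (λ x → Bool.T? (not (signEq (f (swap (proj₁ p) (proj₂ p) x)) (f x)))) (slice n r))

  module _ {n k : ℕ} (f : Cube n → Sign) (gs : Vec (Cube n → Bool) k) (monotone : AllMonotone gs)
           (f≡xorAll : ∀ x → bit (f x) ≡ xorAll gs x) where

    ∑-flips≤ : ∀ r → ∑[ p ∈ pairs n ] flips f r p ≤ ∑[ g ∈ toList gs ] Boundary.chargedEdges g r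
    ∑-flips≤ r = begin
      ∑[ p ∈ pairs n ] flips f r p
        ≡⟨ ∑-cong (pairs n) (λ p → trans (length-filter-T? (slice n r) _) (∑-slice n r _)) ⟩
      ∑[ p ∈ pairs n ] sliceSum n r (flip-f p)
        ≡⟨ sliceSum-∑ n r (pairs n) flip-f ⟨
      sliceSum n r (λ x → ∑[ p ∈ pairs n ] flip-f p x)
        ≤⟨ sliceSum-mono-≤ n r (λ x _ → ∑-mono-≤ (pairs n) (λ p → flip-f≤ p x)) ⟩
      sliceSum n r (λ x → ∑[ p ∈ pairs n ] ∑[ g ∈ toList gs ] flip-g g p x)
        ≡⟨ sliceSum-cong n r (λ x _ → ∑-comm (pairs n) (toList gs) (λ p g → flip-g g p x)) ⟩
      sliceSum n r (λ x → ∑[ g ∈ toList gs ] ∑[ p ∈ pairs n ] flip-g g p x)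
        ≡⟨ sliceSum-∑ n r (toList gs) (λ g x → ∑[ p ∈ pairs n ] flip-g g p x) ⟩
      ∑[ g ∈ toList gs ] sliceSum n r (λ x → ∑[ p ∈ pairs n ] flip-g g p x)
        ≤⟨ ∑-allMonotone-≤ monotone (λ g g-mono → MonotoneBoundary.sliceSum-flips≤ g g-mono r) ⟩
      ∑[ g ∈ toList gs ] Boundary.chargedEdges g r ∎
      where
      open ℕ.≤-Reasoning
      flip-f : Fin n × Fin n → Cube n → ℕ
      flip-f (i , j) x = ⟦ not (signEq (f (swap i j x)) (f x)) ⟧
      flip-g : (Cube n → Bool) → Fin n × Fin n → Cube n → ℕ
      flip-g g (i , j) x = ⟦ g (swap i j x) xor g x ⟧
      flip-f≤ : ∀ p x → flip-f p x ≤ ∑[ g ∈ toList gs ] flip-g g p x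
      flip-f≤ (i , j) x = subst (_≤ ∑[ g ∈ toList gs ] flip-g g (i , j) x)
        (cong ⟦_⟧ (sym (trans (not-signEq (f (swap i j x)) (f x)) (cong₂ _xor_ (f≡xorAll (swap i j x)) (f≡xorAll x)))))
        (xorAll-flip≤ gs (swap i j x) x)

  toℚᵘ-frac : ∀ a d → toℚᵘ (frac a (suc d)) ℚᵘ.≃ mkℚᵘ (pos a) d
  toℚᵘ-frac a d = ℚ.toℚᵘ-fromℚᵘ (mkℚᵘ (pos a) d)

  frac-mono-≤ : ∀ a b D E .{{_ : ℕ.NonZero D}} .{{_ : ℕ.NonZero E}} → a * E ≤ b * D → frac a D ≤ℚ frac b E
  frac-mono-≤ a b (suc d) (suc e) aE≤bD = ℚ.toℚᵘ-cancel-≤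
    (ℚᵘ.≤-respˡ-≃ (ℚᵘ.≃-sym (toℚᵘ-frac a d)) (ℚᵘ.≤-respʳ-≃ (ℚᵘ.≃-sym (toℚᵘ-frac b e))
      (*≤* (subst₂ ℤ._≤_ (ℤ.pos-* a (suc e)) (ℤ.pos-* b (suc d)) (+≤+ aE≤bD)))))

  frac-cong : ∀ a b D E .{{_ : ℕ.NonZero D}} .{{_ : ℕ.NonZero E}} → a * E ≡ b * D → frac a D ≡ frac b E
  frac-cong a b D E aE≡bD =
    ℚ.≤-antisym (frac-mono-≤ a b D E (ℕ.≤-reflexive aE≡bD)) (frac-mono-≤ b a E D (ℕ.≤-reflexive (sym aE≡bD)))

  frac-+ : ∀ a b D E .{{_ : ℕ.NonZero D}} .{{_ : ℕ.NonZero E}} → frac a D +ℚ frac b E ≡ frac (a * E + b * D) (D * E)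
  frac-+ a b D@(suc d) E@(suc e) = ℚ.toℚᵘ-injective (ℚᵘ.≃-trans (ℚ.toℚᵘ-homo-+ (frac a D) (frac b E))
    (ℚᵘ.≃-trans (ℚᵘ.+-cong (toℚᵘ-frac a d) (toℚᵘ-frac b e))
      (ℚᵘ.≃-trans (*≡* numerators) (ℚᵘ.≃-sym (toℚᵘ-frac (a * E + b * D) (e + d * E))))))
    where
    numerators : (pos a ℤ.* pos E ℤ.+ pos b ℤ.* pos D) ℤ.* pos (D * E) ≡ pos (a * E + b * D) ℤ.* pos (D * E)
    numerators = cong (ℤ._* pos (D * E))
      (trans (cong₂ ℤ._+_ (sym (ℤ.pos-* a E)) (sym (ℤ.pos-* b D))) (sym (ℤ.pos-+ (a * E) (b * D))))

  frac-+-same : ∀ a b D .{{_ : ℕ.NonZero D}} → frac a D +ℚ frac b D ≡ frac (a + b) D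
  frac-+-same a b D@(suc _) = trans (frac-+ a b D D) (frac-cong (a * D + b * D) (a + b) (D * D) D (regroup D))
    where
    regroup : ∀ D → (a * D + b * D) * D ≡ (a + b) * (D * D)
    regroup D = solve (a ∷ b ∷ D ∷ [])

  frac-1-* : ∀ a M D .{{_ : ℕ.NonZero M}} .{{_ : ℕ.NonZero D}} → frac 1 M *ℚ frac a D ≡ frac a (M * D)
  frac-1-* a M@(suc m) D@(suc d) = ℚ.toℚᵘ-injective (ℚᵘ.≃-trans (ℚ.toℚᵘ-homo-* (frac 1 M) (frac a D))
    (ℚᵘ.≃-trans (ℚᵘ.*-cong (toℚᵘ-frac 1 m) (toℚᵘ-frac a d))
      (ℚᵘ.≃-trans (*≡* (cong (ℤ._* pos (M * D)) (ℤ.*-identityˡ (pos a)))) (ℚᵘ.≃-sym (toℚᵘ-frac a (d + m * D))))))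

  frac-monoˡ-≤ : ∀ a b D .{{_ : ℕ.NonZero D}} → a ≤ b → frac a D ≤ℚ frac b D
  frac-monoˡ-≤ a b D a≤b = frac-mono-≤ a b D D (ℕ.*-monoˡ-≤ D a≤b)

  sumℚ-map-frac : ∀ {A : Set} (xs : List A) (c : A → ℕ) D .{{_ : ℕ.NonZero D}} →
    sumℚ (map (λ x → frac (c x) D) xs) ≡ frac (∑ xs c) D
  sumℚ-map-frac []       c D@(suc _) = sym (ℚ.0/n≡0 D)
  sumℚ-map-frac (x ∷ xs) c D = trans (cong (frac (c x) D +ℚ_) (sumℚ-map-frac xs c D)) (frac-+-same (c x) (∑ xs c) D)

  ∑ℚ : ℕ → (ℕ → ℚ) → ℚ
  ∑ℚ zero      x = 0ℚ
  ∑ℚ (suc len) x = x 0 +ℚ ∑ℚ len (λ r → x (suc r))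

  sumℚ-applyUpTo : ∀ len (f : ℕ → ℕ) (x : ℕ → ℚ) → sumℚ (map x (applyUpTo f len)) ≡ ∑ℚ len (λ r → x (f r))
  sumℚ-applyUpTo zero      f x = refl
  sumℚ-applyUpTo (suc len) f x = cong (x (f 0) +ℚ_) (sumℚ-applyUpTo len (λ r → f (suc r)) x)

  ∑ℚ-mono-≤ : ∀ len {x y : ℕ → ℚ} → (∀ r → r < len → x r ≤ℚ y r) → ∑ℚ len x ≤ℚ ∑ℚ len y
  ∑ℚ-mono-≤ zero      x≤y = ℚ.≤-refl
  ∑ℚ-mono-≤ (suc len) x≤y = ℚ.+-mono-≤ (x≤y 0 (s≤s z≤n)) (∑ℚ-mono-≤ len (λ r r<len → x≤y (suc r) (s≤s r<len)))

  ∑ℚ-zero : ∀ len → ∑ℚ len (λ _ → 0ℚ) ≡ 0ℚ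
  ∑ℚ-zero zero      = refl
  ∑ℚ-zero (suc len) = trans (ℚ.+-identityˡ _) (∑ℚ-zero len)

  ∑ℚ-distrib-+ : ∀ len (x y : ℕ → ℚ) → ∑ℚ len (λ r → x r +ℚ y r) ≡ ∑ℚ len x +ℚ ∑ℚ len y
  ∑ℚ-distrib-+ zero      x y = refl
  ∑ℚ-distrib-+ (suc len) x y = trans (cong (x 0 +ℚ y 0 +ℚ_) (∑ℚ-distrib-+ len (λ r → x (suc r)) (λ r → y (suc r))))
                                     (+ℚ-interchange (x 0) (y 0) _ _)

  ∑ℚ-telescope : ∀ len (x y : ℕ → ℚ) → (∀ r → r < len → x r +ℚ y r ≤ℚ y (suc r)) → ∑ℚ len x +ℚ y 0 ≤ℚ y len
  ∑ℚ-telescope zero      x y step = ℚ.≤-reflexive (ℚ.+-identityˡ (y 0))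
  ∑ℚ-telescope (suc len) x y step = begin
    (x 0 +ℚ ∑ℚ len x′) +ℚ y 0 ≡⟨ cong (_+ℚ y 0) (ℚ.+-comm (x 0) (∑ℚ len x′)) ⟩
    (∑ℚ len x′ +ℚ x 0) +ℚ y 0 ≡⟨ ℚ.+-assoc (∑ℚ len x′) (x 0) (y 0) ⟩
    ∑ℚ len x′ +ℚ (x 0 +ℚ y 0) ≤⟨ ℚ.+-monoʳ-≤ (∑ℚ len x′) (step 0 (s≤s z≤n)) ⟩
    ∑ℚ len x′ +ℚ y 1          ≤⟨ ∑ℚ-telescope len x′ (λ r → y (suc r)) (λ r r<len → step (suc r) (s≤s r<len)) ⟩
    y (suc len)               ∎
    where
    open ℚ.≤-Reasoning
    x′ : ℕ → ℚ
    x′ r = x (suc r)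

  ∑ℚ-telescope-≤ : ∀ len {c} (x y : ℕ → ℚ) → (∀ r → r < len → x r +ℚ y r ≤ℚ y (suc r)) →
                   0ℚ ≤ℚ y 0 → y len ≤ℚ c → ∑ℚ len x ≤ℚ c
  ∑ℚ-telescope-≤ len {c} x y step 0≤y₀ yₗ≤c = begin
    ∑ℚ len x        ≡⟨ ℚ.+-identityʳ _ ⟨
    ∑ℚ len x +ℚ 0ℚ  ≤⟨ ℚ.+-monoʳ-≤ (∑ℚ len x) 0≤y₀ ⟩
    ∑ℚ len x +ℚ y 0 ≤⟨ ∑ℚ-telescope len x y step ⟩
    y len           ≤⟨ yₗ≤c ⟩
    c               ∎
    where open ℚ.≤-Reasoning

  -- The telescoping bound

  4*-≤-square : ∀ a b → 4 * (a * b) ≤ (a + b) * (a + b)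
  4*-≤-square a b with ℕ.≤-total a b
  ... | inj₁ a≤b = subst (λ b → 4 * (a * b) ≤ (a + b) * (a + b)) (ℕ.m+[n∸m]≡n a≤b) (gap a (b ∸ a))
    where
    gap : ∀ a c → 4 * (a * (a + c)) ≤ (a + (a + c)) * (a + (a + c))
    gap a c = ℕ.≤-trans (ℕ.m≤m+n _ (c * c)) (ℕ.≤-reflexive (solve (a ∷ c ∷ [])))
  ... | inj₂ b≤a = subst (λ a → 4 * (a * b) ≤ (a + b) * (a + b)) (ℕ.m+[n∸m]≡n b≤a) (gap b (a ∸ b))
    where
    gap : ∀ b c → 4 * ((b + c) * b) ≤ ((b + c) + b) * ((b + c) + b)
    gap b c = ℕ.≤-trans (ℕ.m≤m+n _ (c * c)) (ℕ.≤-reflexive (solve (b ∷ c ∷ [])))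

  -- B = X (N′/S′ − N/S), with X = q S = c S′, written without subtraction or division.
  balance : ∀ {B N N′ S S′ q c} → B + q * N ≡ c * N′ → q * S ≡ c * S′ → B * S * S′ + q * S * N * S′ ≡ q * S * N′ * S
  balance {B} {N} {N′} {S} {S′} {q} {c} edges sizes = begin
    B * S * S′ + q * S * N * S′ ≡⟨ solve (B ∷ N ∷ S ∷ S′ ∷ q ∷ []) ⟩
    (B + q * N) * (S * S′)      ≡⟨ cong (_* (S * S′)) edges ⟩
    c * N′ * (S * S′)           ≡⟨ solve (N′ ∷ S ∷ S′ ∷ c ∷ []) ⟩
    c * S′ * N′ * S             ≡⟨ cong (λ t → t * N′ * S) sizes ⟨
    q * S * N′ * S              ∎
    where open ≡-Reasoning

  -- Cross-multiplied, 2pB/(nT) + nN/(2S) ≤ nN′/(2S′); it reduces to 4pq ≤ (p + q)².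
  telescoping-step-ℕ : ∀ p q .{{_ : ℕ.NonZero q}} {n} B T N S N′ S′ → p + q ≡ n →
    B * S * S′ + q * T * N * S′ ≡ q * T * N′ * S →
    (2 * (p * B) * (2 * S) + n * N * (n * T)) * (2 * S′) ≤ n * N′ * (n * T * (2 * S))
  telescoping-step-ℕ p q B T N S N′ S′ refl balanced = ℕ.*-cancelʳ-≤ _ _ q (begin
    (2 * (p * B) * (2 * S) + (p + q) * N * ((p + q) * T)) * (2 * S′) * q
      ≡⟨ solve (p ∷ q ∷ B ∷ T ∷ N ∷ S ∷ S′ ∷ []) ⟩
    4 * (p * q) * (2 * (B * S * S′)) + 2 * (p + q) * (p + q) * (q * T * N * S′)
      ≤⟨ ℕ.+-monoˡ-≤ _ (ℕ.*-monoˡ-≤ (2 * (B * S * S′)) (4*-≤-square p q)) ⟩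
    (p + q) * (p + q) * (2 * (B * S * S′)) + 2 * (p + q) * (p + q) * (q * T * N * S′)
      ≡⟨ solve (p ∷ q ∷ B ∷ T ∷ N ∷ S ∷ S′ ∷ []) ⟩
    2 * (p + q) * (p + q) * (B * S * S′ + q * T * N * S′)
      ≡⟨ cong (2 * (p + q) * (p + q) *_) balanced ⟩
    2 * (p + q) * (p + q) * (q * T * N′ * S)
      ≡⟨ solve (p ∷ q ∷ T ∷ S ∷ N′ ∷ []) ⟩
    (p + q) * N′ * ((p + q) * T * (2 * S)) * q ∎)
    where open ℕ.≤-Reasoning

  telescoping-step : ∀ p q .{{_ : ℕ.NonZero q}} {n} B T N S N′ S′
    .{{_ : ℕ.NonZero n}} .{{_ : ℕ.NonZero T}} .{{_ : ℕ.NonZero S}} .{{_ : ℕ.NonZero S′}} → p + q ≡ n →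
    B * S * S′ + q * T * N * S′ ≡ q * T * N′ * S →
    frac (2 * (p * B)) (n * T) +ℚ frac (n * N) (2 * S) ≤ℚ frac (n * N′) (2 * S′)
  telescoping-step p q {n@(suc _)} B T@(suc _) N S@(suc _) N′ S′@(suc _) p+q≡n balanced =
    subst (_≤ℚ frac (n * N′) (2 * S′)) (sym (frac-+ (2 * (p * B)) (n * N) (n * T) (2 * S)))
          (frac-mono-≤ (2 * (p * B) * (2 * S) + n * N * (n * T)) (n * N′) (n * T * (2 * S)) (2 * S′)
                       (telescoping-step-ℕ p q B T N S N′ S′ p+q≡n balanced))

  module Telescope (m : ℕ) where

    n : ℕ
    n = suc m

    predSize : ℕ → ℕ
    predSize r = ℕ.pred (sliceSize n r)

    -- |slice r|, written as a successor so that instance search finds NonZero (S r).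
    S : ℕ → ℕ
    S r = suc (predSize r)

    sliceSize≡S : ∀ r → r ≤ n → sliceSize n r ≡ S r
    sliceSize≡S r r≤n = sym (ℕ.suc-pred _ {{ℕ.>-nonZero (sliceSum-1-positive n r r≤n)}})

    S-step : ∀ r → r < n → (n ∸ r) * S r ≡ suc r * S (suc r)
    S-step r r<n = subst₂ (λ a b → (n ∸ r) * a ≡ suc r * b)
      (sliceSize≡S r (ℕ.<⇒≤ r<n)) (sliceSize≡S (suc r) r<n) (sliceSize-step n r)

    module _ (g : Cube n → Bool) (g-mono : Monotone g) where
      open Boundary g
      open MonotoneBoundary g g-mono

      height : ℕ → ℚ
      height r = frac (n * positives r) (2 * S r)

      aboveTerm belowTerm : ℕ → ℚ
      aboveTerm r = frac (2 * (r * edgesAbove r)) (n * S r)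
      belowTerm r = frac (2 * ((n ∸ r) * edgesBelow r)) (n * S r)

      0≤height : ∀ r → 0ℚ ≤ℚ height r
      0≤height r = frac-mono-≤ 0 (n * positives r) 1 (2 * S r) z≤n

      height≤ : ∀ r → r ≤ n → height r ≤ℚ frac n 2
      height≤ r r≤n = frac-mono-≤ (n * positives r) n (2 * S r) 2 (begin
        n * positives r * 2   ≤⟨ ℕ.*-monoˡ-≤ 2 (ℕ.*-monoʳ-≤ n (positives≤sliceSize r)) ⟩
        n * sliceSize n r * 2 ≡⟨ cong (λ s → n * s * 2) (sliceSize≡S r r≤n) ⟩
        n * S r * 2           ≡⟨ trans (ℕ.*-assoc n (S r) 2) (cong (n *_) (ℕ.*-comm (S r) 2)) ⟩
        n * (2 * S r)         ∎)
        where open ℕ.≤-Reasoning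

      edges-balance : ∀ r → r < n →
        edgesAbove r * S r * S (suc r) + (n ∸ r) * S r * positives r * S (suc r) ≡ (n ∸ r) * S r * positives (suc r) * S r
      edges-balance r r<n = balance {edgesAbove r} {positives r} {positives (suc r)} {S r} {S (suc r)} {n ∸ r} {suc r}
                                    (edgesAbove+positives r) (S-step r r<n)

      above-step : ∀ r → r < n → aboveTerm r +ℚ height r ≤ℚ height (suc r)
      above-step r r<n =
        telescoping-step r (n ∸ r) {{ℕ.>-nonZero (ℕ.m<n⇒0<n∸m r<n)}}
          (edgesAbove r) (S r) (positives r) (S r) (positives (suc r)) (S (suc r))
          (ℕ.m+[n∸m]≡n (ℕ.<⇒≤ r<n)) (edges-balance r r<n)

      below-step : ∀ r → suc r < n → belowTerm (suc r) +ℚ height r ≤ℚ height (suc r)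
      below-step r r+1<n =
        subst (λ B → frac (2 * ((n ∸ suc r) * B)) (n * S (suc r)) +ℚ height r ≤ℚ height (suc r))
              (sym (edgesBelow-suc r))
              (telescoping-step (n ∸ suc r) (suc r)
                (edgesAbove r) (S (suc r)) (positives r) (S r) (positives (suc r)) (S (suc r))
                (ℕ.m∸n+n≡m (ℕ.<⇒≤ r+1<n))
                (subst (λ X → edgesAbove r * S r * S (suc r) + X * positives r * S (suc r) ≡ X * positives (suc r) * S r)
                       (S-step r r<n) (edges-balance r r<n)))
        where
        r<n = ℕ.<-trans (ℕ.n<1+n r) r+1<n

      belowTerm-zero : belowTerm 0 ≡ 0ℚ
      belowTerm-zero = begin
        frac (2 * (n * edgesBelow 0)) (n * S 0)
          ≡⟨ cong (λ B → frac (2 * B) (n * S 0)) (trans (cong (n *_) edgesBelow-zero) (ℕ.*-zeroʳ n)) ⟩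
        frac 0 (n * S 0)
          ≡⟨ ℚ.0/n≡0 (n * S 0) ⟩
        0ℚ ∎
        where open ≡-Reasoning

      ∑-aboveTerm≤ : ∑ℚ n aboveTerm ≤ℚ frac n 2
      ∑-aboveTerm≤ = ∑ℚ-telescope-≤ n aboveTerm height above-step (0≤height 0) (height≤ n ℕ.≤-refl)

      ∑-belowTerm≤ : ∑ℚ n belowTerm ≤ℚ frac n 2
      ∑-belowTerm≤ = begin
        belowTerm 0 +ℚ ∑ℚ m (λ r → belowTerm (suc r)) ≡⟨ cong (_+ℚ ∑ℚ m (λ r → belowTerm (suc r))) belowTerm-zero ⟩
        0ℚ +ℚ ∑ℚ m (λ r → belowTerm (suc r))          ≡⟨ ℚ.+-identityˡ _ ⟩
        ∑ℚ m (λ r → belowTerm (suc r))                 ≤⟨ ∑ℚ-telescope-≤ m _ height (λ r r<m → below-step r (s≤s r<m))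
                                                                           (0≤height 0) (height≤ m (ℕ.n≤1+n m)) ⟩
        frac n 2                                       ∎
        where open ℚ.≤-Reasoning

      ∑-chargedEdges≤ : ∑ℚ n (λ r → frac (2 * chargedEdges r) (n * S r)) ≤ℚ frac n 1
      ∑-chargedEdges≤ = begin
        ∑ℚ n (λ r → frac (2 * chargedEdges r) (n * S r))
          ≤⟨ ∑ℚ-mono-≤ n (λ r _ → ℚ.≤-reflexive (split r)) ⟩
        ∑ℚ n (λ r → aboveTerm r +ℚ belowTerm r) ≡⟨ ∑ℚ-distrib-+ n aboveTerm belowTerm ⟩
        ∑ℚ n aboveTerm +ℚ ∑ℚ n belowTerm        ≤⟨ ℚ.+-mono-≤ ∑-aboveTerm≤ ∑-belowTerm≤ ⟩
        frac n 2 +ℚ frac n 2                    ≡⟨ frac-+-same n n 2 ⟩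
        frac (n + n) 2                          ≡⟨ frac-cong (n + n) n 2 1 (doubled n) ⟩
        frac n 1                                ∎
        where
        open ℚ.≤-Reasoning
        doubled : ∀ a → (a + a) * 1 ≡ a * 2
        doubled a = solve (a ∷ [])
        split : ∀ r → frac (2 * chargedEdges r) (n * S r) ≡ aboveTerm r +ℚ belowTerm r
        split r = trans (cong (λ c → frac c (n * S r)) (ℕ.*-distribˡ-+ 2 (r * edgesAbove r) _))
                        (sym (frac-+-same (2 * (r * edgesAbove r)) (2 * ((n ∸ r) * edgesBelow r)) (n * S r)))

    ∑-allChargedEdges≤ : ∀ {k} (gs : Vec (Cube n → Bool) k) → AllMonotone gs →
      ∑ℚ n (λ r → frac (2 * ∑[ g ∈ toList gs ] Boundary.chargedEdges g r) (n * S r)) ≤ℚ frac (k * n) 1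
    ∑-allChargedEdges≤ []ᵥ []ᵐ = begin
      ∑ℚ n (λ r → frac 0 (n * S r)) ≤⟨ ∑ℚ-mono-≤ n (λ r _ → ℚ.≤-reflexive (ℚ.0/n≡0 (n * S r))) ⟩
      ∑ℚ n (λ _ → 0ℚ)               ≡⟨ ∑ℚ-zero n ⟩
      0ℚ                            ∎
      where open ℚ.≤-Reasoning
    ∑-allChargedEdges≤ {suc k} (g ∷ᵥ gs) (g-mono ∷ᵐ monotone) = begin
      ∑ℚ n (λ r → frac (2 * (chargedEdges g r + rest r)) (n * S r))
        ≤⟨ ∑ℚ-mono-≤ n (λ r _ → ℚ.≤-reflexive (split r)) ⟩
      ∑ℚ n (λ r → frac (2 * chargedEdges g r) (n * S r) +ℚ frac (2 * rest r) (n * S r))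
        ≡⟨ ∑ℚ-distrib-+ n (λ r → frac (2 * chargedEdges g r) (n * S r)) (λ r → frac (2 * rest r) (n * S r)) ⟩
      ∑ℚ n (λ r → frac (2 * chargedEdges g r) (n * S r)) +ℚ ∑ℚ n (λ r → frac (2 * rest r) (n * S r))
        ≤⟨ ℚ.+-mono-≤ (∑-chargedEdges≤ g g-mono) (∑-allChargedEdges≤ gs monotone) ⟩
      frac n 1 +ℚ frac (k * n) 1
        ≡⟨ frac-+-same n (k * n) 1 ⟩
      frac (suc k * n) 1 ∎
      where
      open ℚ.≤-Reasoning
      open Boundary using (chargedEdges)
      rest : ℕ → ℕ
      rest r = ∑[ g ∈ toList gs ] chargedEdges g r
      split : ∀ r → frac (2 * (chargedEdges g r + rest r)) (n * S r) ≡ frac (2 * chargedEdges g r) (n * S r) +ℚ frac (2 * rest r) (n * S r)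
      split r = trans (cong (λ c → frac c (n * S r)) (ℕ.*-distribˡ-+ 2 (chargedEdges g r) (rest r)))
                      (sym (frac-+-same (2 * chargedEdges g r) (2 * rest r) (n * S r)))

    Inf≤ : ∀ {k} (f : Cube n → Sign) (gs : Vec (Cube n → Bool) k) → AllMonotone gs → (∀ x → bit (f x) ≡ xorAll gs x) →
      ∀ r → r < n → Inf f r ≤ℚ frac (2 * ∑[ g ∈ toList gs ] Boundary.chargedEdges g r) (n * S r)
    Inf≤ f gs monotone f≡xorAll r r<n = begin
      frac 1 n *ℚ sumℚ (map (λ p → frac (2 * flips′ p) (length (slice n r))) (pairs n))
        ≡⟨ cong (λ L → frac 1 n *ℚ sumℚ (map (λ p → frac (2 * flips′ p) L) (pairs n))) |slice|≡S ⟩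
      frac 1 n *ℚ sumℚ (map (λ p → frac (2 * flips′ p) (S r)) (pairs n))
        ≡⟨ cong (frac 1 n *ℚ_) (sumℚ-map-frac (pairs n) (λ p → 2 * flips′ p) (S r)) ⟩
      frac 1 n *ℚ frac (∑[ p ∈ pairs n ] (2 * flips′ p)) (S r)
        ≡⟨ frac-1-* (∑[ p ∈ pairs n ] (2 * flips′ p)) n (S r) ⟩
      frac (∑[ p ∈ pairs n ] (2 * flips′ p)) (n * S r)
        ≤⟨ frac-monoˡ-≤ _ _ (n * S r) (ℕ.≤-trans (ℕ.≤-reflexive (∑-*ˡ (pairs n) 2 flips′))
                                             (ℕ.*-monoʳ-≤ 2 (∑-flips≤ f gs monotone f≡xorAll r))) ⟩
      frac (2 * ∑[ g ∈ toList gs ] Boundary.chargedEdges g r) (n * S r) ∎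
      where
      open ℚ.≤-Reasoning
      flips′ = flips f r
      |slice|≡S : length (slice n r) ≡ S r
      |slice|≡S = trans (length≡∑1 (slice n r)) (trans (∑-slice n r (λ _ → 1)) (sliceSize≡S r (ℕ.<⇒≤ r<n)))

open import Data.Nat using (ℕ; zero; suc; _*_; z≤n)
open import Data.Integer using (+_)
open import Data.Rational using (_≤_; _/_)
open import Data.Sign using (Sign)
open import Data.Vec using (toList)
open import Data.Product using (_,_)
import Data.Rational.Properties as ℚ

proposition2 : (n k : ℕ) (f : Cube n → Sign) → KMonotone k f →
    sliceInfSum f ≤ (+ (k * n)) / 1
proposition2 zero    k f _ = frac-mono-≤ 0 (k * 0) 1 1 z≤n
proposition2 (suc m) k f (gs , monotone , f≡xorAll) = begin
  sliceInfSum f                                                                ≡⟨ sumℚ-applyUpTo n (λ r → r) (Inf f) ⟩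
  ∑ℚ n (Inf f)                                                                 ≤⟨ ∑ℚ-mono-≤ n (Inf≤ f gs monotone f≡xorAll) ⟩
  ∑ℚ n (λ r → frac (2 * ∑[ g ∈ toList gs ] Boundary.chargedEdges g r) (n * S r)) ≤⟨ ∑-allChargedEdges≤ gs monotone ⟩
  (+ (k * n)) / 1                                                              ∎
  where
  open ℚ.≤-Reasoning
  open Telescope m
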